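{- Let $G$ be a finite simple graph. Then $G$ has an optimal semi-proper orientation $(D,w)$ such that $w(e)\in\{1,2\}$ for every edge $e\in E(G)$.
   Context: All graphs are finite, simple and undirected. An orientation $D$ of $G$ replaces each edge $uv$ by exactly one of the arcs $u\to v$ or $v\to u$. A semi-proper orientation of $G$ is a pair $(D,w)$ where $D$ is an orientation of $G$ and $w:E(G)\to\mathbb{Z}_{>0}$ is a positive integer weight function, such that for every two adjacent vertices $u,v$ we have $S_{(D,w)}(u)\neq S_{(D,w)}(v)$, where $S_{(D,w)}(v)=\sum_{z\in N^-_D(v)} w(zv)$ is the sum of the weights of the edges whose head is $v$ in $D$. The semi-proper orientation number is $\overrightarrow{\chi}_s(G)=\min_{(D,w)\in\Gamma}\max_{v\in V(G)} S_{(D,w)}(v)$, where $\Gamma$ is the set of all semi-proper orientations of $G$. An optimal semi-proper orientation is a semi-proper orientation $(D,w)$ with $\max_{v\in V(G)} S_{(D,w)}(v)=\overrightarrow{\chi}_s(G)$. -}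

module Defs where

open import Data.Nat using (ℕ; _⊔_; _≤_; _<_)
open import Data.Fin using (Fin)
open import Data.Bool using (Bool; true; false; if_then_else_)
open import Data.List using (List; map; foldr; allFin)
open import Data.Nat.ListAction using (sum)
open import Data.Product using (_×_; Σ; ∃)
open import Data.Sum using (_⊎_)
open import Relation.Binary.PropositionalEquality using (_≡_; _≢_)

record Graph : Set where
  field
    n     : ℕ
    adj   : Fin n → Fin n → Bool
    sym   : ∀ u v → adj u v ≡ adj v u
    irref : ∀ v → adj v v ≡ false

open Graph public

Adj : (G : Graph) → Fin (n G) → Fin (n G) → Set
Adj G u v = adj G u v ≡ true

-- An orientation: dir u v ≡ true means the edge uv is oriented u → v.
-- Exactly one direction is chosen for every edge.
record Orientation (G : Graph) : Set where
  field
    dir   : Fin (n G) → Fin (n G) → Bool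
    exact : ∀ u v → Adj G u v → dir u v ≢ dir v u

open Orientation public

record Weight (G : Graph) : Set where
  field
    wt    : Fin (n G) → Fin (n G) → ℕ
    wsym  : ∀ u v → wt u v ≡ wt v u
    wpos  : ∀ u v → Adj G u v → 0 < wt u v

open Weight public

S : (G : Graph) → Orientation G → Weight G → Fin (n G) → ℕ
S G D w v = sum (map (λ u → if adj G u v then (if dir D u v then wt w u v else 0) else 0)
                     (allFin (n G)))

maxS : (G : Graph) → Orientation G → Weight G → ℕ
maxS G D w = foldr _⊔_ 0 (map (S G D w) (allFin (n G)))

SemiProper : (G : Graph) → Orientation G → Weight G → Set
SemiProper G D w = ∀ u v → Adj G u v → S G D w u ≢ S G D w v

Optimal : (G : Graph) → Orientation G → Weight G → Set
Optimal G D w = SemiProper G D w ×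
  (∀ (D' : Orientation G) (w' : Weight G) → SemiProper G D' w' → maxS G D w ≤ maxS G D' w')

module Submission where

-- Let (D, w) be semi-proper with an arc u → v of weight at least 3.  One of four
-- local moves (rebalance, reroute, drain, relabel; see `improve`) produces a semi-proper
-- (D′, w′) with maxS not larger and with smaller potential (Σ S, Σ S·d⁺, Σ w²) in the
-- lexicographic order.  This order is well-founded, so iterating (`reduce`) ends in a
-- semi-proper orientation, no worse than (D, w), whose weights all lie in {1, 2}.
--
-- Orientations with weights in {1, 2} are coded by finitely many bits, so it is
-- decidable whether one of them is semi-proper with maxS ≤ k.  Starting from an explicit
-- semi-proper orientation (orient by index, weights powers of N + 1), take the least such k;
-- by the reduction every semi-proper orientation has maxS ≥ k, so the code attaining k is optimal.

open import Data.Nat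
open import Data.Nat.Properties
open import Data.Nat.Induction using (<-wellFounded; <-rec)
open import Data.Nat.ListAction using (sum)
open import Data.Nat.Solver using (module +-*-Solver)
open import Algebra.Properties.CommutativeSemigroup +-commutativeSemigroup using (xy∙z≈xz∙y; x∙yz≈xz∙y)
open import Data.Bool using (Bool; true; false; if_then_else_; not; _∧_; _∨_; T)
open import Data.Bool.Properties using (not-injective; not-involutive; not-¬; ¬-not; ∨-comm) renaming (_≟_ to _≟ᵇ_)
open import Data.Fin using (Fin; zero; suc; toℕ)
open import Data.Fin.Properties using (any?; all?; toℕ-injective) renaming (suc-injective to fsuc-injective; _≟_ to _≟ᶠ_)
open import Data.List using (allFin; map; foldr)
open import Data.Vec using (Vec; []; _∷_; lookup; tabulate)
open import Data.Vec.Properties using (lookup∘tabulate)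
open import Data.List.Properties using (map-tabulate)
open import Data.Product using (_×_; _,_; proj₁; proj₂; Σ; ∃)
open import Data.Product.Relation.Binary.Lex.Strict using (×-Lex; ×-wellFounded)
open import Data.Sum using (_⊎_; inj₁; inj₂)
open import Data.Empty using (⊥; ⊥-elim)
open import Function using (_∘_; id; mk⇔)
open import Induction.WellFounded using (Acc; acc; WellFounded)
open import Relation.Nullary using (Dec; yes; no; does; ¬_)
open import Relation.Nullary.Decidable using (does-⇔; dec-true; dec-false; toWitness; isYes≗does; _×-dec_; _⊎-dec_; _→-dec_; ¬?)
open import Relation.Binary.PropositionalEquality
open import Defs hiding (sym)

open +-*-Solver

sumFin : (n : ℕ) → (Fin n → ℕ) → ℕ
sumFin n f = sum (map f (allFin n))

maxFin : (n : ℕ) → (Fin n → ℕ) → ℕ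
maxFin n f = foldr _⊔_ 0 (map f (allFin n))

sumFin-suc : ∀ n (f : Fin (suc n) → ℕ) → sumFin (suc n) f ≡ f zero + sumFin n (f ∘ suc)
sumFin-suc n f = cong (λ xs → f zero + sum xs)
  (trans (map-tabulate suc f) (sym (map-tabulate id (f ∘ suc))))

sumFin-cong : ∀ n {f g : Fin n → ℕ} → (∀ i → f i ≡ g i) → sumFin n f ≡ sumFin n g
sumFin-cong zero    eq = refl
sumFin-cong (suc n) {f} {g} eq = begin
  sumFin (suc n) f                ≡⟨ sumFin-suc n f ⟩
  f zero + sumFin n (f ∘ suc)     ≡⟨ cong₂ _+_ (eq zero) (sumFin-cong n (eq ∘ suc)) ⟩
  g zero + sumFin n (g ∘ suc)     ≡⟨ sumFin-suc n g ⟨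
  sumFin (suc n) g                ∎
  where open ≡-Reasoning

sumFin-mono : ∀ n {f g : Fin n → ℕ} → (∀ i → f i ≤ g i) → sumFin n f ≤ sumFin n g
sumFin-mono zero    le = z≤n
sumFin-mono (suc n) {f} {g} le rewrite sumFin-suc n f | sumFin-suc n g =
  +-mono-≤ (le zero) (sumFin-mono n (le ∘ suc))

sumFin-strict : ∀ n {f g : Fin n → ℕ} (j : Fin n) → (∀ i → f i ≤ g i) → f j < g j →
                sumFin n f < sumFin n g
sumFin-strict (suc n) {f} {g} zero le lt rewrite sumFin-suc n f | sumFin-suc n g =
  +-mono-<-≤ lt (sumFin-mono n (le ∘ suc))
sumFin-strict (suc n) {f} {g} (suc j) le lt rewrite sumFin-suc n f | sumFin-suc n g =
  +-mono-≤-< (le zero) (sumFin-strict n j (le ∘ suc) lt)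

sumFin-zero : ∀ n {f : Fin n → ℕ} → (∀ i → f i ≡ 0) → sumFin n f ≡ 0
sumFin-zero zero    eq = refl
sumFin-zero (suc n) {f} eq rewrite sumFin-suc n f | eq zero = sumFin-zero n (eq ∘ suc)

sumFin-term : ∀ n {f : Fin n → ℕ} (j : Fin n) → f j ≤ sumFin n f
sumFin-term (suc n) {f} zero    rewrite sumFin-suc n f = m≤m+n _ _
sumFin-term (suc n) {f} (suc j) rewrite sumFin-suc n f =
  ≤-trans (sumFin-term n {f ∘ suc} j) (m≤n+m _ _)

sumFin-bound : ∀ n {f : Fin n → ℕ} (b : ℕ) → (∀ i → f i ≤ b) → sumFin n f ≤ n * b
sumFin-bound zero    b le = z≤n
sumFin-bound (suc n) {f} b le rewrite sumFin-suc n f = +-mono-≤ (le zero) (sumFin-bound n b (le ∘ suc))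

sumFin-+ : ∀ n (f g : Fin n → ℕ) → sumFin n (λ i → f i + g i) ≡ sumFin n f + sumFin n g
sumFin-+ zero    f g = refl
sumFin-+ (suc n) f g
  rewrite sumFin-suc n (λ i → f i + g i) | sumFin-suc n f | sumFin-suc n g | sumFin-+ n (f ∘ suc) (g ∘ suc) =
  solve 4 (λ a b x y → (a :+ b) :+ (x :+ y) := (a :+ x) :+ (b :+ y)) refl
    (f zero) (g zero) (sumFin n (f ∘ suc)) (sumFin n (g ∘ suc))

sumFin-update : ∀ n {f g : Fin n → ℕ} (j : Fin n) → (∀ i → i ≢ j → f i ≡ g i) →
                sumFin n f + g j ≡ sumFin n g + f j
sumFin-update (suc n) {f} {g} zero eq
  rewrite sumFin-suc n f | sumFin-suc n g | sumFin-cong n {f ∘ suc} {g ∘ suc} (λ i → eq (suc i) (λ ())) =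
  solve 3 (λ a b x → (a :+ x) :+ b := (b :+ x) :+ a) refl (f zero) (g zero) (sumFin n (g ∘ suc))
sumFin-update (suc n) {f} {g} (suc j) eq rewrite sumFin-suc n f | sumFin-suc n g | eq zero (λ ()) =
  trans (+-assoc (g zero) _ _)
    (trans (cong (g zero +_) (sumFin-update n {f ∘ suc} {g ∘ suc} j (λ i i≢j → eq (suc i) (i≢j ∘ fsuc-injective))))
           (sym (+-assoc (g zero) _ _)))

sumFin-update₂ : ∀ n {f g : Fin n → ℕ} (j k : Fin n) → j ≢ k → (∀ i → i ≢ j → i ≢ k → f i ≡ g i) →
                 sumFin n f + g j + g k ≡ sumFin n g + f j + f k
sumFin-update₂ n {f} {g} j k j≢k eq = begin
  sumFin n f + g j + g k  ≡⟨ cong (λ x → sumFin n f + x + g k) h-at-j ⟨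
  sumFin n f + h j + g k  ≡⟨ cong (_+ g k) (sumFin-update n {f} {h} j f≡h) ⟩
  sumFin n h + f j + g k  ≡⟨ xy∙z≈xz∙y (sumFin n h) (f j) (g k) ⟩
  sumFin n h + g k + f j  ≡⟨ cong (_+ f j) (sumFin-update n {h} {g} k h≡g) ⟩
  sumFin n g + h k + f j  ≡⟨ cong (λ x → sumFin n g + x + f j) h-at-k ⟩
  sumFin n g + f k + f j  ≡⟨ xy∙z≈xz∙y (sumFin n g) (f k) (f j) ⟩
  sumFin n g + f j + f k  ∎
  where
  open ≡-Reasoning
  h : Fin n → ℕ
  h i = if does (i ≟ᶠ j) then g j else f i
  f≡h : ∀ i → i ≢ j → f i ≡ h i
  f≡h i i≢j with i ≟ᶠ j
  ... | yes i≡j = ⊥-elim (i≢j i≡j)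
  ... | no  _   = refl
  h-at-j : h j ≡ g j
  h-at-j with j ≟ᶠ j
  ... | yes _   = refl
  ... | no  j≢j = ⊥-elim (j≢j refl)
  h-at-k : h k ≡ f k
  h-at-k with k ≟ᶠ j
  ... | yes k≡j = ⊥-elim (j≢k (sym k≡j))
  ... | no  _   = refl
  h≡g : ∀ i → i ≢ k → h i ≡ g i
  h≡g i i≢k with i ≟ᶠ j
  ... | yes refl = refl
  ... | no  i≢j  = eq i i≢j i≢k

sumFin-shift-< : ∀ n (s d d′ : Fin n → ℕ) v z → v ≢ z → d′ v + 1 ≡ d v → d′ z ≡ d z + 1 →
                 (∀ x → x ≢ v → x ≢ z → d′ x ≡ d x) → s z < s v →
                 sumFin n (λ x → s x * d′ x) < sumFin n (λ x → s x * d x)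
sumFin-shift-< n s d d′ v z v≢z at-v at-z elsewhere sz<sv =
  +-cancelʳ-< (s v) _ _ (subst (_< G + s v) (sym F+sv≡G+sz) (+-monoʳ-< G sz<sv))
  where
  open ≡-Reasoning
  F G : ℕ
  F = sumFin n (λ x → s x * d′ x)
  G = sumFin n (λ x → s x * d x)
  F+sv≡G+sz : F + s v ≡ G + s z
  F+sv≡G+sz = +-cancelʳ-≡ (s v * d′ v + s z * d z) _ _ (begin
    F + s v + (s v * d′ v + s z * d z)
      ≡⟨ solve 5 (λ F sv sz a b → F :+ sv :+ (sv :* a :+ sz :* b) := F :+ sv :* (a :+ con 1) :+ sz :* b)
               refl F (s v) (s z) (d′ v) (d z) ⟩
    F + s v * (d′ v + 1) + s z * d z  ≡⟨ cong (λ k → F + s v * k + s z * d z) at-v ⟩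
    F + s v * d v + s z * d z
      ≡⟨ sumFin-update₂ n v z v≢z (λ x x≢v x≢z → cong (s x *_) (elsewhere x x≢v x≢z)) ⟩
    G + s v * d′ v + s z * d′ z        ≡⟨ cong (λ k → G + s v * d′ v + s z * k) at-z ⟩
    G + s v * d′ v + s z * (d z + 1)
      ≡⟨ solve 5 (λ G sv sz a b → G :+ sv :* a :+ sz :* (b :+ con 1) := G :+ sz :+ (sv :* a :+ sz :* b))
               refl G (s v) (s z) (d′ v) (d z) ⟩
    G + s z + (s v * d′ v + s z * d z)  ∎)

maxFin-suc : ∀ n (f : Fin (suc n) → ℕ) → maxFin (suc n) f ≡ f zero ⊔ maxFin n (f ∘ suc)
maxFin-suc n f = cong (λ xs → f zero ⊔ foldr _⊔_ 0 xs)
  (trans (map-tabulate suc f) (sym (map-tabulate id (f ∘ suc))))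

maxFin-lub : ∀ n {f : Fin n → ℕ} {m} → (∀ i → f i ≤ m) → maxFin n f ≤ m
maxFin-lub zero    le = z≤n
maxFin-lub (suc n) {f} le rewrite maxFin-suc n f = ⊔-lub (le zero) (maxFin-lub n (le ∘ suc))

maxFin-ub : ∀ n {f : Fin n → ℕ} (i : Fin n) → f i ≤ maxFin n f
maxFin-ub (suc n) {f} zero    rewrite maxFin-suc n f = m≤m⊔n _ _
maxFin-ub (suc n) {f} (suc i) rewrite maxFin-suc n f = ≤-trans (maxFin-ub n {f ∘ suc} i) (m≤n⊔m _ _)

maxFin-mono : ∀ n {f g : Fin n → ℕ} → (∀ i → f i ≤ g i) → maxFin n f ≤ maxFin n g
maxFin-mono n le = maxFin-lub n (λ i → ≤-trans (le i) (maxFin-ub n i))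

-- Counting principle: if every value t in [lo, lo + k) is attained as val i at
-- some index i of multiplicity mult i ≥ 1, then k ≤ Σ mult.  Induction on the
-- number of indices; a used index 0 accounts for its own value, and the values
-- above it are shifted down by one to close the gap in the interval.
pigeonhole : ∀ n (mult val : Fin n → ℕ) lo k →
             (∀ t → lo ≤ t → t < lo + k → ∃ λ i → 1 ≤ mult i × val i ≡ t) → k ≤ sumFin n mult
pigeonhole zero    mult val lo zero    covered = z≤n
pigeonhole zero    mult val lo (suc k) covered with covered lo ≤-refl (m<m+n lo z<s)
... | () , _
pigeonhole (suc n) mult val lo k covered with 1 ≤? mult zero
... | no unused rewrite sumFin-suc n mult =
  ≤-trans (pigeonhole n (mult ∘ suc) (val ∘ suc) lo k covered′) (m≤n+m _ _)
  where
  covered′ : ∀ t → lo ≤ t → t < lo + k → ∃ λ i → 1 ≤ mult (suc i) × val (suc i) ≡ t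
  covered′ t lo≤t t<hi with covered t lo≤t t<hi
  ... | zero  , used , _ = ⊥-elim (unused used)
  ... | suc i , used , v = i , used , v
pigeonhole (suc n) mult val lo zero    covered | yes used = z≤n
pigeonhole (suc n) mult val lo (suc k) covered | yes used rewrite sumFin-suc n mult =
  +-mono-≤ used (pigeonhole n (mult ∘ suc) shifted lo k covered′)
  where
  shifted : Fin n → ℕ
  shifted i with val (suc i) <? val zero
  ... | yes _ = val (suc i)
  ... | no  _ = pred (val (suc i))
  shifted-below : ∀ i → val (suc i) < val zero → shifted i ≡ val (suc i)
  shifted-below i lt with val (suc i) <? val zero
  ... | yes _ = refl
  ... | no ≮ = ⊥-elim (≮ lt)
  shifted-above : ∀ i → ¬ (val (suc i) < val zero) → shifted i ≡ pred (val (suc i))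
  shifted-above i ≮ with val (suc i) <? val zero
  ... | yes lt = ⊥-elim (≮ lt)
  ... | no _ = refl
  covered′ : ∀ t → lo ≤ t → t < lo + k → ∃ λ i → 1 ≤ mult (suc i) × shifted i ≡ t
  covered′ t lo≤t t<hi with t <? val zero
  ... | yes t<v₀ with covered t lo≤t (≤-trans t<hi (+-monoʳ-≤ lo (n≤1+n k)))
  ...   | zero  , _    , v = ⊥-elim (<⇒≢ t<v₀ (sym v))
  ...   | suc i , used , v = i , used , trans (shifted-below i (subst (_< val zero) (sym v) t<v₀)) v
  covered′ t lo≤t t<hi | no t≮v₀
    with covered (suc t) (m≤n⇒m≤1+n lo≤t) (subst (suc t <_) (sym (+-suc lo k)) (s≤s t<hi))
  ...   | zero  , _    , v = ⊥-elim (t≮v₀ (≤-reflexive (sym v)))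
  ...   | suc i , used , v =
    i , used , trans (shifted-above i (λ lt → t≮v₀ (<⇒≤ (subst (_< val zero) v lt)))) (cong pred v)

least : ∀ {Q : ℕ → Set} → (∀ k → Dec (Q k)) → ∀ K → Q K → ∃ λ k → Q k × (∀ j → j < k → ¬ Q j)
least {Q} Q? = <-rec (λ K → Q K → ∃ λ k → Q k × (∀ j → j < k → ¬ Q j)) step
  where
  step : ∀ K → (∀ {j} → j < K → Q j → ∃ λ k → Q k × (∀ i → i < k → ¬ Q i)) →
         Q K → ∃ λ k → Q k × (∀ i → i < k → ¬ Q i)
  step K smaller qK with anyUpTo? Q? K
  ... | yes (j , j<K , qj) = smaller j<K qj
  ... | no  none           = K , qK , λ j j<K qj → none (j , j<K , qj)

Exhaustible : Set → Set₁
Exhaustible A = ∀ (P : A → Set) → (∀ a → Dec (P a)) → Dec (∃ P)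

exhaustible-Bool : Exhaustible Bool
exhaustible-Bool P P? with P? true | P? false
... | yes p | _     = yes (true , p)
... | no  _ | yes p = yes (false , p)
... | no ¬t | no ¬f = no λ { (true , p) → ¬t p ; (false , p) → ¬f p }

exhaustible-× : ∀ {A B} → Exhaustible A → Exhaustible B → Exhaustible (A × B)
exhaustible-× {A} {B} exA exB P P? with exA (λ a → ∃ λ b → P (a , b)) (λ a → exB (λ b → P (a , b)) (λ b → P? (a , b)))
... | yes (a , b , p) = yes ((a , b) , p)
... | no  none        = no λ { ((a , b) , p) → none (a , b , p) }

exhaustible-Vec : ∀ {A} → Exhaustible A → ∀ n → Exhaustible (Vec A n)
exhaustible-Vec exA zero    P P? with P? []
... | yes p = yes ([] , p)
... | no ¬p = no λ { ([] , p) → ¬p p }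
exhaustible-Vec exA (suc n) P P?
  with exA (λ a → ∃ λ v → P (a ∷ v)) (λ a → exhaustible-Vec exA n (λ v → P (a ∷ v)) (λ v → P? (a ∷ v)))
... | yes (a , v , p) = yes (a ∷ v , p)
... | no  none        = no λ { (a ∷ v , p) → none (a , v , p) }

square : ℕ → ℕ
square x = x * x

-- Weight arithmetic of a rebalancing move: lowering a weight 3 + c by one and raising
-- a weight 1 by one preserves the sum and strictly lowers the sum of squares.
rebalance-sum : ∀ a b c → a + 1 + (3 + c) ≡ b + 2 + (2 + c) → a ≡ b
rebalance-sum a b c eq = +-cancelʳ-≡ (4 + c) a b (begin
  a + (4 + c)      ≡⟨ solve 2 (λ a c → a :+ (con 4 :+ c) := a :+ con 1 :+ (con 3 :+ c)) refl a c ⟩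
  a + 1 + (3 + c)  ≡⟨ eq ⟩
  b + 2 + (2 + c)  ≡⟨ solve 2 (λ b c → b :+ con 2 :+ (con 2 :+ c) := b :+ (con 4 :+ c)) refl b c ⟩
  b + (4 + c)      ∎)
  where open ≡-Reasoning

rebalance-squares : ∀ a b c → a + square 1 + square (3 + c) ≡ b + square 2 + square (2 + c) → a < b
rebalance-squares a b c eq = subst (a <_) a+2+2c≡b (m<m+n a z<s)
  where
  open ≡-Reasoning
  a+2+2c≡b : a + (2 + 2 * c) ≡ b
  a+2+2c≡b = +-cancelʳ-≡ (4 + square (2 + c)) _ _ (begin
    a + (2 + 2 * c) + (4 + square (2 + c))
      ≡⟨ solve 2 (λ a c → a :+ (con 2 :+ con 2 :* c) :+ (con 4 :+ (con 2 :+ c) :* (con 2 :+ c))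
                       := a :+ con 1 :* con 1 :+ (con 3 :+ c) :* (con 3 :+ c)) refl a c ⟩
    a + square 1 + square (3 + c)  ≡⟨ eq ⟩
    b + square 2 + square (2 + c)  ≡⟨ +-assoc b 4 (square (2 + c)) ⟩
    b + (4 + square (2 + c))       ∎)

positive≢1⇒2≤ : ∀ k → 0 < k → k ≢ 1 → 2 ≤ k
positive≢1⇒2≤ (suc zero)    _ k≢1 = ⊥-elim (k≢1 refl)
positive≢1⇒2≤ (suc (suc k)) _ _   = s≤s (s≤s z≤n)

one-or-two : ∀ {k} → 0 < k → ¬ (3 ≤ k) → (k ≡ 1) ⊎ (k ≡ 2)
one-or-two {suc zero}          _ _  = inj₁ refl
one-or-two {suc (suc zero)}    _ _  = inj₂ refl
one-or-two {suc (suc (suc k))} _ ≱3 = ⊥-elim (≱3 (s≤s (s≤s (s≤s z≤n))))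

weightOf : Bool → ℕ
weightOf b = if b then 2 else 1

weightOf-pos : ∀ b → 0 < weightOf b
weightOf-pos true  = z<s
weightOf-pos false = z<s

weightOf-12 : ∀ b → (weightOf b ≡ 1) ⊎ (weightOf b ≡ 2)
weightOf-12 true  = inj₂ refl
weightOf-12 false = inj₁ refl

weightOf-code : ∀ {k} → (k ≡ 1) ⊎ (k ≡ 2) → weightOf (does (k ≟ 2)) ≡ k
weightOf-code (inj₁ refl) = refl
weightOf-code (inj₂ refl) = refl

true≢false : true ≢ false
true≢false ()

at-or-away : ∀ {n} {P : Fin n → Set} v → P v → (∀ y → y ≢ v → P y) → ∀ y → P y
at-or-away v at away y with y ≟ᶠ v
... | yes refl = at
... | no  y≢v  = away y y≢v

module _ (G : Graph) where

  private
    N : ℕ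
    N = n G

  Adj-sym : ∀ {x y} → Adj G x y → Adj G y x
  Adj-sym {x} {y} xy = trans (Graph.sym G y x) xy

  Adj-irrefl : ∀ {x y} → Adj G x y → x ≢ y
  Adj-irrefl {x} xy refl with () ← trans (sym (irref G x)) xy

  dir-reverse : ∀ (D : Orientation G) {x y} → Adj G x y → dir D y x ≡ not (dir D x y)
  dir-reverse D xy = ¬-not (exact D _ _ (Adj-sym xy))

  reverse-of-arc : ∀ (D : Orientation G) {x y} → Adj G x y → dir D x y ≡ true → dir D y x ≡ false
  reverse-of-arc D xy x→y rewrite dir-reverse D xy | x→y = refl

  arc-of-reverse : ∀ (D : Orientation G) {x y} → Adj G x y → dir D x y ≡ false → dir D y x ≡ true
  arc-of-reverse D xy y→x rewrite dir-reverse D xy | y→x = refl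

  arc : Orientation G → (Fin N → Fin N → ℕ) → Fin N → Fin N → ℕ
  arc D k x y = if adj G x y then (if dir D x y then k x y else 0) else 0

  arc-present : ∀ D k {x y} → Adj G x y → dir D x y ≡ true → arc D k x y ≡ k x y
  arc-present D k xy x→y rewrite xy | x→y = refl

  arc-absent : ∀ D k {x y} → (Adj G x y → dir D x y ≡ true → ⊥) → arc D k x y ≡ 0
  arc-absent D k {x} {y} ¬x→y with adj G x y | dir D x y
  ... | true  | true  = ⊥-elim (¬x→y refl refl)
  ... | true  | false = refl
  ... | false | _     = refl

  arc-reverse : ∀ D k {x y} → Adj G x y → dir D x y ≡ true → arc D k y x ≡ 0
  arc-reverse D k xy x→y = arc-absent D k (λ _ y→x → true≢false (trans (sym y→x) (reverse-of-arc D xy x→y)))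

  arc-cong : ∀ D k k′ {x y} → (Adj G x y → dir D x y ≡ true → k x y ≡ k′ x y) → arc D k x y ≡ arc D k′ x y
  arc-cong D k k′ {x} {y} eq with adj G x y | dir D x y
  ... | true  | true  = eq refl refl
  ... | true  | false = refl
  ... | false | _     = refl

  -- Σ over tails x of φ applied to the arc x → y; φ = id gives S, φ = square a quadratic measure.
  inflow : (ℕ → ℕ) → Orientation G → (Fin N → Fin N → ℕ) → Fin N → ℕ
  inflow φ D k y = sumFin N (λ x → φ (arc D k x y))

  outflow : Orientation G → (Fin N → Fin N → ℕ) → Fin N → ℕ
  outflow D k x = sumFin N (λ y → arc D k x y)

  arc≤S : ∀ D (w : Weight G) x y → arc D (wt w) x y ≤ S G D w y
  arc≤S D w x y = sumFin-term N {λ x → arc D (wt w) x y} x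

  weight≤S : ∀ D (w : Weight G) {x y} → Adj G x y → dir D x y ≡ true → wt w x y ≤ S G D w y
  weight≤S D w {x} {y} xy x→y = subst (_≤ S G D w y) (arc-present D (wt w) xy x→y) (arc≤S D w x y)

  S-positive : ∀ D (w : Weight G) {x y} → Adj G x y → dir D x y ≡ true → 0 < S G D w y
  S-positive D w xy x→y = ≤-trans (wpos w _ _ xy) (weight≤S D w xy x→y)

  SamePair : Fin N → Fin N → Fin N → Fin N → Set
  SamePair a b x y = (x ≡ a × y ≡ b) ⊎ (x ≡ b × y ≡ a)

  samePair? : ∀ a b x y → Dec (SamePair a b x y)
  samePair? a b x y = ((x ≟ᶠ a) ×-dec (y ≟ᶠ b)) ⊎-dec ((x ≟ᶠ b) ×-dec (y ≟ᶠ a))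

  pairᵇ : Fin N → Fin N → Fin N → Fin N → Bool
  pairᵇ a b x y = does (samePair? a b x y)

  pairᵇ-sym : ∀ a b x y → pairᵇ a b x y ≡ pairᵇ a b y x
  pairᵇ-sym a b x y = does-⇔ (mk⇔ swap swap) (samePair? a b x y) (samePair? a b y x)
    where
    swap : ∀ {x y} → SamePair a b x y → SamePair a b y x
    swap (inj₁ (x≡a , y≡b)) = inj₂ (y≡b , x≡a)
    swap (inj₂ (x≡b , y≡a)) = inj₁ (y≡a , x≡b)

  pairᵇ-ab : ∀ a b → pairᵇ a b a b ≡ true
  pairᵇ-ab a b = dec-true (samePair? a b a b) (inj₁ (refl , refl))

  pairᵇ-ba : ∀ a b → pairᵇ a b b a ≡ true
  pairᵇ-ba a b = dec-true (samePair? a b b a) (inj₂ (refl , refl))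

  pairᵇ-other : ∀ {a b x y} → ¬ SamePair a b x y → pairᵇ a b x y ≡ false
  pairᵇ-other {a} {b} {x} {y} = dec-false (samePair? a b x y)

  pairᵇ-true : ∀ {a b x y} → pairᵇ a b x y ≡ true → SamePair a b x y
  pairᵇ-true {a} {b} {x} {y} eq =
    toWitness {a? = same?} (subst T (sym (trans (isYes≗does same?) eq)) _)
    where
    same? : Dec (SamePair a b x y)
    same? = samePair? a b x y

  flip : Orientation G → Fin N → Fin N → Orientation G
  flip D a b = record { dir = dir′ ; exact = exact′ }
    where
    dir′ : Fin N → Fin N → Bool
    dir′ x y = if pairᵇ a b x y then not (dir D x y) else dir D x y
    exact′ : ∀ x y → Adj G x y → dir′ x y ≢ dir′ y x
    exact′ x y xy rewrite pairᵇ-sym a b y x with pairᵇ a b x y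
    ... | true  = exact D x y xy ∘ not-injective
    ... | false = exact D x y xy

  reweight : Weight G → Fin N → Fin N → (k : ℕ) → 0 < k → Weight G
  reweight w a b k 0<k = record { wt = wt′ ; wsym = wsym′ ; wpos = wpos′ }
    where
    wt′ : Fin N → Fin N → ℕ
    wt′ x y = if pairᵇ a b x y then k else wt w x y
    wsym′ : ∀ x y → wt′ x y ≡ wt′ y x
    wsym′ x y rewrite pairᵇ-sym a b y x with pairᵇ a b x y
    ... | true  = refl
    ... | false = wsym w x y
    wpos′ : ∀ x y → Adj G x y → 0 < wt′ x y
    wpos′ x y xy with pairᵇ a b x y
    ... | true  = 0<k
    ... | false = wpos w x y xy

  reweight-other : ∀ w a b k 0<k {x y} → ¬ SamePair a b x y → wt (reweight w a b k 0<k) x y ≡ wt w x y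
  reweight-other w a b k 0<k ne rewrite pairᵇ-other ne = refl

  flip-other : ∀ D a b {x y} → ¬ SamePair a b x y → dir (flip D a b) x y ≡ dir D x y
  flip-other D a b ne rewrite pairᵇ-other ne = refl

  module ArcEdit (D : Orientation G) {a b : Fin N} (ab : Adj G a b) (a→b : dir D a b ≡ true) where

    a≢b : a ≢ b
    a≢b = Adj-irrefl ab

    reweight-arc : ∀ w k 0<k {x y} → ¬ (x ≡ a × y ≡ b) →
                   arc D (wt (reweight w a b k 0<k)) x y ≡ arc D (wt w) x y
    reweight-arc w k 0<k {x} {y} ¬ab = arc-cong D (wt (reweight w a b k 0<k)) (wt w) unchanged
      where
      unchanged : Adj G x y → dir D x y ≡ true → wt (reweight w a b k 0<k) x y ≡ wt w x y
      unchanged xy x→y with pairᵇ a b x y in same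
      ... | false = refl
      ... | true with pairᵇ-true same
      ...   | inj₁ x,y≡a,b       = ⊥-elim (¬ab x,y≡a,b)
      ...   | inj₂ (refl , refl) = ⊥-elim (true≢false (trans (sym x→y) (reverse-of-arc D ab a→b)))

    inflow-reweight-other : ∀ φ w k 0<k y → y ≢ b →
                            inflow φ D (wt (reweight w a b k 0<k)) y ≡ inflow φ D (wt w) y
    inflow-reweight-other φ w k 0<k y y≢b =
      sumFin-cong N (λ x → cong φ (reweight-arc w k 0<k (y≢b ∘ proj₂)))

    inflow-reweight-head : ∀ φ w k 0<k →
                           inflow φ D (wt (reweight w a b k 0<k)) b + φ (wt w a b) ≡ inflow φ D (wt w) b + φ k
    inflow-reweight-head φ w k 0<k = begin
      inflow φ D (wt w′) b + φ (wt w a b)       ≡⟨ cong (λ c → inflow φ D (wt w′) b + φ c) (arc-present D (wt w) ab a→b) ⟨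
      inflow φ D (wt w′) b + φ (arc D (wt w) a b) ≡⟨ sumFin-update N a (λ x x≢a → cong φ (reweight-arc w k 0<k (x≢a ∘ proj₁))) ⟩
      inflow φ D (wt w) b + φ (arc D (wt w′) a b) ≡⟨ cong (λ c → inflow φ D (wt w) b + φ c) new-weight ⟩
      inflow φ D (wt w) b + φ k                 ∎
      where
      open ≡-Reasoning
      w′ : Weight G
      w′ = reweight w a b k 0<k
      new-weight : arc D (wt w′) a b ≡ k
      new-weight rewrite arc-present D (wt w′) ab a→b | pairᵇ-ab a b = refl

    flip-reversed : dir (flip D a b) b a ≡ true
    flip-reversed rewrite pairᵇ-ba a b | reverse-of-arc D ab a→b = refl

    flip-arc-other : ∀ k {x y} → ¬ SamePair a b x y → arc (flip D a b) k x y ≡ arc D k x y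
    flip-arc-other k ne rewrite flip-other D a b ne = refl

    flip-arc-ab : ∀ k → arc (flip D a b) k a b ≡ 0
    flip-arc-ab k rewrite ab | pairᵇ-ab a b | a→b = refl

    flip-arc-ba : ∀ k → arc (flip D a b) k b a ≡ k b a
    flip-arc-ba k rewrite Adj-sym ab | pairᵇ-ba a b | reverse-of-arc D ab a→b = refl

    inflow-flip-other : ∀ k y → y ≢ a → y ≢ b → inflow id (flip D a b) k y ≡ inflow id D k y
    inflow-flip-other k y y≢a y≢b = sumFin-cong N (λ x → flip-arc-other k
      λ { (inj₁ (_ , y≡b)) → y≢b y≡b ; (inj₂ (_ , y≡a)) → y≢a y≡a })

    inflow-flip-head : ∀ k → inflow id (flip D a b) k b + k a b ≡ inflow id D k b
    inflow-flip-head k = begin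
      inflow id (flip D a b) k b + k a b      ≡⟨ cong (inflow id (flip D a b) k b +_) (arc-present D k ab a→b) ⟨
      inflow id (flip D a b) k b + arc D k a b ≡⟨ sumFin-update N a (λ x x≢a → flip-arc-other k
                                                   λ { (inj₁ (x≡a , _)) → x≢a x≡a ; (inj₂ (_ , b≡a)) → a≢b (sym b≡a) }) ⟩
      inflow id D k b + arc (flip D a b) k a b ≡⟨ cong (inflow id D k b +_) (flip-arc-ab k) ⟩
      inflow id D k b + 0                     ≡⟨ +-identityʳ _ ⟩
      inflow id D k b                         ∎
      where open ≡-Reasoning

    inflow-flip-tail : ∀ k → inflow id (flip D a b) k a ≡ inflow id D k a + k b a
    inflow-flip-tail k = begin
      inflow id (flip D a b) k a                ≡⟨ +-identityʳ _ ⟨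
      inflow id (flip D a b) k a + 0            ≡⟨ cong (inflow id (flip D a b) k a +_) (arc-reverse D k ab a→b) ⟨
      inflow id (flip D a b) k a + arc D k b a  ≡⟨ sumFin-update N b (λ x x≢b → flip-arc-other k
                                                   λ { (inj₁ (_ , a≡b)) → a≢b a≡b ; (inj₂ (x≡b , _)) → x≢b x≡b }) ⟩
      inflow id D k a + arc (flip D a b) k b a  ≡⟨ cong (inflow id D k a +_) (flip-arc-ba k) ⟩
      inflow id D k a + k b a                   ∎
      where open ≡-Reasoning

    outflow-flip-other : ∀ k x → x ≢ a → x ≢ b → outflow (flip D a b) k x ≡ outflow D k x
    outflow-flip-other k x x≢a x≢b = sumFin-cong N (λ y → flip-arc-other k
      λ { (inj₁ (x≡a , _)) → x≢a x≡a ; (inj₂ (x≡b , _)) → x≢b x≡b })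

    outflow-flip-tail : ∀ k → outflow (flip D a b) k a + k a b ≡ outflow D k a
    outflow-flip-tail k = begin
      outflow (flip D a b) k a + k a b        ≡⟨ cong (outflow (flip D a b) k a +_) (arc-present D k ab a→b) ⟨
      outflow (flip D a b) k a + arc D k a b  ≡⟨ sumFin-update N b (λ y y≢b → flip-arc-other k
                                                   λ { (inj₁ (_ , y≡b)) → y≢b y≡b ; (inj₂ (a≡b , _)) → a≢b a≡b }) ⟩
      outflow D k a + arc (flip D a b) k a b  ≡⟨ cong (outflow D k a +_) (flip-arc-ab k) ⟩
      outflow D k a + 0                       ≡⟨ +-identityʳ _ ⟩
      outflow D k a                           ∎
      where open ≡-Reasoning

    outflow-flip-head : ∀ k → outflow (flip D a b) k b ≡ outflow D k b + k b a
    outflow-flip-head k = begin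
      outflow (flip D a b) k b                ≡⟨ +-identityʳ _ ⟨
      outflow (flip D a b) k b + 0            ≡⟨ cong (outflow (flip D a b) k b +_) (arc-reverse D k ab a→b) ⟨
      outflow (flip D a b) k b + arc D k b a  ≡⟨ sumFin-update N a (λ y y≢a → flip-arc-other k
                                                   λ { (inj₁ (b≡a , _)) → a≢b (sym b≡a) ; (inj₂ (_ , y≡a)) → y≢a y≡a }) ⟩
      outflow D k b + arc (flip D a b) k b a  ≡⟨ cong (outflow D k b +_) (flip-arc-ba k) ⟩
      outflow D k b + k b a                   ∎
      where open ≡-Reasoning

  semiProper-≗ : ∀ D D′ w w′ → SemiProper G D w → (∀ y → S G D′ w′ y ≡ S G D w y) → SemiProper G D′ w′
  semiProper-≗ D D′ w w′ sp same x y xy rewrite same x | same y = sp x y xy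

  maxS-mono : ∀ D D′ w w′ → (∀ y → S G D′ w′ y ≤ S G D w y) → maxS G D′ w′ ≤ maxS G D w
  maxS-mono D D′ w w′ = maxFin-mono N

  semiProper-update : ∀ D D′ w w′ v → SemiProper G D w → (∀ y → y ≢ v → S G D′ w′ y ≡ S G D w y) →
                      (∀ x → Adj G x v → S G D′ w′ x ≢ S G D′ w′ v) → SemiProper G D′ w′
  semiProper-update D D′ w w′ v sp same fresh x y xy with x ≟ᶠ v | y ≟ᶠ v
  ... | yes refl | _        = fresh y (Adj-sym xy) ∘ sym
  ... | no  _    | yes refl = fresh x xy
  ... | no  x≢v  | no  y≢v  rewrite same x x≢v | same y y≢v = sp x y xy

  one : Fin N → Fin N → ℕ
  one _ _ = 1

  indeg : Orientation G → Fin N → ℕ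
  indeg D = inflow id D one

  outdeg : Orientation G → Fin N → ℕ
  outdeg D = outflow D one

  totalLoad : Orientation G → Weight G → ℕ
  totalLoad D w = sumFin N (S G D w)

  outLoad : Orientation G → Weight G → ℕ
  outLoad D w = sumFin N (λ x → S G D w x * outdeg D x)

  squareLoad : Orientation G → Weight G → ℕ
  squareLoad D w = sumFin N (inflow square D (wt w))

  potential : Orientation G → Weight G → ℕ × ℕ × ℕ
  potential D w = totalLoad D w , outLoad D w , squareLoad D w

  _⊏_ : ℕ × ℕ × ℕ → ℕ × ℕ × ℕ → Set
  _⊏_ = ×-Lex _≡_ _<_ (×-Lex _≡_ _<_ _<_)

  ⊏-wellFounded : WellFounded _⊏_
  ⊏-wellFounded = ×-wellFounded <-wellFounded (×-wellFounded <-wellFounded <-wellFounded)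

  record Improvement (D : Orientation G) (w : Weight G) : Set where
    field
      D′       : Orientation G
      w′       : Weight G
      proper   : SemiProper G D′ w′
      no-worse : maxS G D′ w′ ≤ maxS G D w
      smaller  : potential D′ w′ ⊏ potential D w

  sameS-improvement : ∀ D D′ w w′ → SemiProper G D w → (∀ y → S G D′ w′ y ≡ S G D w y) →
                      ×-Lex _≡_ _<_ _<_ (outLoad D′ w′ , squareLoad D′ w′) (outLoad D w , squareLoad D w) →
                      Improvement D w
  sameS-improvement D D′ w w′ sp same smaller =
    record { D′ = D′ ; w′ = w′ ; proper = semiProper-≗ D D′ w w′ sp same
           ; no-worse = maxS-mono D D′ w w′ (≤-reflexive ∘ same) ; smaller = inj₂ (sumFin-cong N same , smaller) }

  lowerS-improvement : ∀ D D′ w w′ v → SemiProper G D′ w′ → (∀ y → S G D′ w′ y ≤ S G D w y) →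
                       S G D′ w′ v < S G D w v → Improvement D w
  lowerS-improvement D D′ w w′ v sp′ le lt =
    record { D′ = D′ ; w′ = w′ ; proper = sp′ ; no-worse = maxS-mono D D′ w w′ le
           ; smaller = inj₁ (sumFin-strict N v le lt) }

  -- Move 1 (rebalance).  Two arcs u → v, x → v of weights 3 + c and 1 become 2 + c and 2:
  -- S is unchanged and the sum of squared weights drops.
  module Rebalance (D : Orientation G) (w : Weight G) {u x v : Fin N}
                   (uv : Adj G u v) (u→v : dir D u v ≡ true) (xv : Adj G x v) (x→v : dir D x v ≡ true)
                   (c : ℕ) (heavy : wt w u v ≡ 3 + c) (light : wt w x v ≡ 1) where

    private
      module U = ArcEdit D uv u→v
      module X = ArcEdit D xv x→v

    w₁ : Weight G
    w₁ = reweight w u v (2 + c) z<s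

    w₂ : Weight G
    w₂ = reweight w₁ x v 2 z<s

    light₁ : wt w₁ x v ≡ 1
    light₁ = trans (reweight-other w u v (2 + c) z<s distinct) light
      where
      distinct : ¬ SamePair u v x v
      distinct (inj₁ (refl , _)) with () ← trans (sym light) heavy
      distinct (inj₂ (_ , v≡u)) = Adj-irrefl uv (sym v≡u)

    inflow-at-v : ∀ φ → inflow φ D (wt w₂) v + φ 1 + φ (3 + c) ≡ inflow φ D (wt w) v + φ 2 + φ (2 + c)
    inflow-at-v φ = begin
      inflow φ D (wt w₂) v + φ 1 + φ (3 + c)           ≡⟨ cong (λ k → inflow φ D (wt w₂) v + φ k + φ (3 + c)) light₁ ⟨
      inflow φ D (wt w₂) v + φ (wt w₁ x v) + φ (3 + c) ≡⟨ cong (_+ φ (3 + c)) (X.inflow-reweight-head φ w₁ 2 z<s) ⟩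
      inflow φ D (wt w₁) v + φ 2 + φ (3 + c)           ≡⟨ xy∙z≈xz∙y (inflow φ D (wt w₁) v) _ _ ⟩
      inflow φ D (wt w₁) v + φ (3 + c) + φ 2           ≡⟨ cong (λ k → inflow φ D (wt w₁) v + φ k + φ 2) heavy ⟨
      inflow φ D (wt w₁) v + φ (wt w u v) + φ 2        ≡⟨ cong (_+ φ 2) (U.inflow-reweight-head φ w (2 + c) z<s) ⟩
      inflow φ D (wt w) v + φ (2 + c) + φ 2            ≡⟨ xy∙z≈xz∙y (inflow φ D (wt w) v) _ _ ⟩
      inflow φ D (wt w) v + φ 2 + φ (2 + c)            ∎
      where open ≡-Reasoning

    inflow-elsewhere : ∀ φ y → y ≢ v → inflow φ D (wt w₂) y ≡ inflow φ D (wt w) y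
    inflow-elsewhere φ y y≢v =
      trans (X.inflow-reweight-other φ w₁ 2 z<s y y≢v) (U.inflow-reweight-other φ w (2 + c) z<s y y≢v)

    S-unchanged : ∀ y → S G D w₂ y ≡ S G D w y
    S-unchanged = at-or-away v (rebalance-sum _ _ c (inflow-at-v id)) (inflow-elsewhere id)

    squareLoad-< : squareLoad D w₂ < squareLoad D w
    squareLoad-< = sumFin-strict N v le (rebalance-squares _ _ c (inflow-at-v square))
      where
      le : ∀ y → inflow square D (wt w₂) y ≤ inflow square D (wt w) y
      le = at-or-away v (<⇒≤ (rebalance-squares _ _ c (inflow-at-v square)))
                        (λ y y≢v → ≤-reflexive (inflow-elsewhere square y y≢v))

    improvement : SemiProper G D w → Improvement D w
    improvement sp = sameS-improvement D D w w₂ sp S-unchanged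
      (inj₂ (sumFin-cong N (λ y → cong (_* outdeg D y) (S-unchanged y)) , squareLoad-<))

  -- Common part of moves 2 and 3.  Given arcs u → v (weight 2 + c) and v → z, reverse
  -- the edge vz into z → v with weight 1 and lower u → v to 1 + c: S is unchanged except
  -- at z, which loses w(vz).
  module Redirect (D : Orientation G) (w : Weight G) {u v z : Fin N}
                  (uv : Adj G u v) (u→v : dir D u v ≡ true) (c : ℕ) (heavy : wt w u v ≡ 2 + c)
                  (vz : Adj G v z) (v→z : dir D v z ≡ true) where

    private
      module VZ = ArcEdit D vz v→z

    v≢z : v ≢ z
    v≢z = Adj-irrefl vz

    u≢z : u ≢ z
    u≢z refl = true≢false (trans (sym u→v) (reverse-of-arc D vz v→z))

    D₁ : Orientation G
    D₁ = flip D v z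

    uv-not-vz : ¬ SamePair v z u v
    uv-not-vz (inj₁ (u≡v , _)) = Adj-irrefl uv u≡v
    uv-not-vz (inj₂ (u≡z , _)) = u≢z u≡z

    private
      module ZV = ArcEdit D₁ (Adj-sym vz) VZ.flip-reversed
      module UV = ArcEdit D₁ uv (trans (flip-other D v z uv-not-vz) u→v)

    w₁ : Weight G
    w₁ = reweight w z v 1 z<s

    w₂ : Weight G
    w₂ = reweight w₁ u v (1 + c) z<s

    heavy₁ : wt w₁ u v ≡ 2 + c
    heavy₁ = trans (reweight-other w z v 1 z<s λ { (inj₁ (u≡z , _)) → u≢z u≡z ; (inj₂ (u≡v , _)) → Adj-irrefl uv u≡v })
                   heavy

    S-at-v : S G D₁ w₂ v ≡ S G D w v
    S-at-v = +-cancelʳ-≡ (2 + c) _ _ (begin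
      S G D₁ w₂ v + (2 + c)            ≡⟨ cong (S G D₁ w₂ v +_) heavy₁ ⟨
      S G D₁ w₂ v + wt w₁ u v          ≡⟨ UV.inflow-reweight-head id w₁ (1 + c) z<s ⟩
      S G D₁ w₁ v + (1 + c)            ≡⟨ cong (_+ (1 + c)) S₁-at-v ⟩
      S G D w v + 1 + (1 + c)          ≡⟨ +-assoc (S G D w v) 1 (1 + c) ⟩
      S G D w v + (2 + c)              ∎)
      where
      open ≡-Reasoning
      S₁-at-v : S G D₁ w₁ v ≡ S G D w v + 1
      S₁-at-v = +-cancelʳ-≡ (wt w z v) _ _ (begin
        S G D₁ w₁ v + wt w z v          ≡⟨ ZV.inflow-reweight-head id w 1 z<s ⟩
        S G D₁ w v + 1                  ≡⟨ cong (_+ 1) (VZ.inflow-flip-tail (wt w)) ⟩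
        S G D w v + wt w z v + 1        ≡⟨ xy∙z≈xz∙y (S G D w v) _ 1 ⟩
        S G D w v + 1 + wt w z v        ∎)

    S-reweights : ∀ y → y ≢ v → S G D₁ w₂ y ≡ S G D₁ w y
    S-reweights y y≢v = trans (UV.inflow-reweight-other id w₁ (1 + c) z<s y y≢v)
                              (ZV.inflow-reweight-other id w 1 z<s y y≢v)

    S-at-z : S G D₁ w₂ z + wt w v z ≡ S G D w z
    S-at-z = trans (cong (_+ wt w v z) (S-reweights z (v≢z ∘ sym))) (VZ.inflow-flip-head (wt w))

    S-elsewhere : ∀ y → y ≢ v → y ≢ z → S G D₁ w₂ y ≡ S G D w y
    S-elsewhere y y≢v y≢z = trans (S-reweights y y≢v) (VZ.inflow-flip-other (wt w) y y≢v y≢z)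

    S-away-from-z : ∀ y → y ≢ z → S G D₁ w₂ y ≡ S G D w y
    S-away-from-z = at-or-away {P = λ y → y ≢ z → S G D₁ w₂ y ≡ S G D w y} v (λ _ → S-at-v) S-elsewhere

  -- If moreover some y ≠ v has an arc y → z and S(z) < S(v), add w(vz)
  -- to the arc y → z: now S is unchanged everywhere, while v lost and z gained an out-arc,
  -- so Σ S·d⁺ drops.
  module Reroute (D : Orientation G) (w : Weight G) {u v z y : Fin N}
                 (uv : Adj G u v) (u→v : dir D u v ≡ true) (c : ℕ) (heavy : wt w u v ≡ 2 + c)
                 (vz : Adj G v z) (v→z : dir D v z ≡ true)
                 (yz : Adj G y z) (y→z : dir D y z ≡ true) (y≢v : y ≢ v)
                 (lower : S G D w z < S G D w v) where

    open Redirect D w uv u→v c heavy vz v→z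

    yz-not-vz : ¬ SamePair v z y z
    yz-not-vz (inj₁ (y≡v , _)) = y≢v y≡v
    yz-not-vz (inj₂ (_ , z≡v)) = v≢z (sym z≡v)

    private
      module VZ = ArcEdit D vz v→z
      module YZ = ArcEdit D₁ yz (trans (flip-other D v z yz-not-vz) y→z)

    0<k₃ : 0 < wt w₂ y z + wt w v z
    0<k₃ = ≤-trans (wpos w₂ y z yz) (m≤m+n _ _)

    w₃ : Weight G
    w₃ = reweight w₂ y z (wt w₂ y z + wt w v z) 0<k₃

    S-unchanged : ∀ x → S G D₁ w₃ x ≡ S G D w x
    S-unchanged = at-or-away z at-z away
      where
      at-z : S G D₁ w₃ z ≡ S G D w z
      at-z = +-cancelʳ-≡ (wt w₂ y z) _ _ (begin
        S G D₁ w₃ z + wt w₂ y z                   ≡⟨ YZ.inflow-reweight-head id w₂ _ 0<k₃ ⟩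
        S G D₁ w₂ z + (wt w₂ y z + wt w v z)      ≡⟨ x∙yz≈xz∙y (S G D₁ w₂ z) _ _ ⟩
        S G D₁ w₂ z + wt w v z + wt w₂ y z        ≡⟨ cong (_+ wt w₂ y z) S-at-z ⟩
        S G D w z + wt w₂ y z                     ∎)
        where open ≡-Reasoning
      away : ∀ x → x ≢ z → S G D₁ w₃ x ≡ S G D w x
      away x x≢z = trans (YZ.inflow-reweight-other id w₂ _ 0<k₃ x x≢z) (S-away-from-z x x≢z)

    outLoad-< : outLoad D₁ w₃ < outLoad D w
    outLoad-< = subst (_< outLoad D w) (sumFin-cong N (λ x → cong (_* outdeg D₁ x) (sym (S-unchanged x))))
      (sumFin-shift-< N (S G D w) (outdeg D) (outdeg D₁) v z v≢z
        (VZ.outflow-flip-tail one) (VZ.outflow-flip-head one) (λ x → VZ.outflow-flip-other one x) lower)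

    improvement : SemiProper G D w → Improvement D w
    improvement sp = sameS-improvement D D₁ w w₃ sp S-unchanged (inj₁ outLoad-<)

  -- Move 3 (drain).  If instead v → z is the only arc into z, the redirected orientation
  -- has S(z) = 0, which differs from S at every neighbour of z; Σ S drops.
  module Drain (D : Orientation G) (w : Weight G) {u v z : Fin N}
               (uv : Adj G u v) (u→v : dir D u v ≡ true) (c : ℕ) (heavy : wt w u v ≡ 2 + c)
               (vz : Adj G v z) (v→z : dir D v z ≡ true)
               (only-v : ∀ x → Adj G x z → dir D x z ≡ true → x ≡ v) where

    open Redirect D w uv u→v c heavy vz v→z

    private
      module VZ = ArcEdit D vz v→z

    z-empty : S G D₁ w₂ z ≡ 0
    z-empty = trans (S-reweights z (v≢z ∘ sym)) (sumFin-zero N (at-or-away v (VZ.flip-arc-ab (wt w)) no-arc))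
      where
      no-arc : ∀ x → x ≢ v → arc D₁ (wt w) x z ≡ 0
      no-arc x x≢v = trans (VZ.flip-arc-other (wt w) λ { (inj₁ (x≡v , _)) → x≢v x≡v ; (inj₂ (_ , z≡v)) → v≢z (sym z≡v) })
                           (arc-absent D (wt w) (λ xz x→z → x≢v (only-v x xz x→z)))

    -- Every neighbour of z is the head of an arc: v of u → v, the others of z → x.
    neighbour-positive : ∀ x → Adj G x z → 0 < S G D w x
    neighbour-positive = at-or-away v (λ _ → S-positive D w uv u→v)
      (λ x x≢v xz → S-positive D w (Adj-sym xz) (arc-of-reverse D xz (¬-not (x≢v ∘ only-v x xz))))

    proper : SemiProper G D w → SemiProper G D₁ w₂
    proper sp = semiProper-update D D₁ w w₂ z sp S-away-from-z fresh
      where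
      fresh : ∀ x → Adj G x z → S G D₁ w₂ x ≢ S G D₁ w₂ z
      fresh x xz rewrite z-empty | S-away-from-z x (Adj-irrefl xz) = >⇒≢ (neighbour-positive x xz)

    S-≤ : ∀ y → S G D₁ w₂ y ≤ S G D w y
    S-≤ = at-or-away z (subst (_≤ S G D w z) (sym z-empty) z≤n) (λ y y≢z → ≤-reflexive (S-away-from-z y y≢z))

    improvement : SemiProper G D w → Improvement D w
    improvement sp = lowerS-improvement D D₁ w w₂ z (proper sp) S-≤
      (subst (_< S G D w z) (sym z-empty) (S-positive D w vz v→z))

  -- Let t be a value with d⁻(v) ≤ t < S(v) taken by no neighbour of v.
  -- Giving every arc into v weight 1, except u → v which gets t + 1 − d⁻(v), makes
  -- S(v) = t and keeps S elsewhere; Σ S drops.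
  module Relabel (D : Orientation G) (w : Weight G) {u v : Fin N}
                 (uv : Adj G u v) (u→v : dir D u v ≡ true) (t : ℕ) (indeg≤t : indeg D v ≤ t)
                 (free : ∀ x → Adj G x v → S G D w x ≢ t) (t<S : t < S G D w v) where

    k : ℕ
    k = suc t ∸ indeg D v

    0<k : 0 < k
    0<k = subst (0 <_) (sym (+-∸-assoc 1 indeg≤t)) z<s

    intoᵇ : Fin N → Fin N → Bool
    intoᵇ p q = (does (q ≟ᶠ v) ∧ dir D p v) ∨ (does (p ≟ᶠ v) ∧ dir D q v)

    wL : Weight G
    wL = record { wt = wt′ ; wsym = wsym′ ; wpos = wpos′ }
      where
      wt′ : Fin N → Fin N → ℕ
      wt′ p q = if pairᵇ u v p q then k else (if intoᵇ p q then 1 else wt w p q)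
      wsym′ : ∀ p q → wt′ p q ≡ wt′ q p
      wsym′ p q rewrite pairᵇ-sym u v q p | ∨-comm (does (q ≟ᶠ v) ∧ dir D p v) (does (p ≟ᶠ v) ∧ dir D q v)
        with pairᵇ u v p q | intoᵇ q p
      ... | true  | _     = refl
      ... | false | true  = refl
      ... | false | false = wsym w p q
      wpos′ : ∀ p q → Adj G p q → 0 < wt′ p q
      wpos′ p q pq with pairᵇ u v p q | intoᵇ p q
      ... | true  | _     = 0<k
      ... | false | true  = z<s
      ... | false | false = wpos w p q pq

    S-at-v : S G D wL v ≡ t
    S-at-v = +-cancelʳ-≡ 1 _ _ (begin
      S G D wL v + 1                  ≡⟨ cong (S G D wL v +_) (arc-present D one uv u→v) ⟨
      S G D wL v + arc D one u v      ≡⟨ sumFin-update N u (λ p p≢u → arc-cong D (wt wL) one (unit p p≢u)) ⟩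
      indeg D v + arc D (wt wL) u v   ≡⟨ cong (indeg D v +_) (arc-present D (wt wL) uv u→v) ⟩
      indeg D v + wt wL u v           ≡⟨ cong (indeg D v +_) new-weight ⟩
      indeg D v + k                   ≡⟨ m+[n∸m]≡n (m≤n⇒m≤1+n indeg≤t) ⟩
      suc t                           ≡⟨ +-comm 1 t ⟩
      t + 1                           ∎)
      where
      open ≡-Reasoning
      new-weight : wt wL u v ≡ k
      new-weight rewrite pairᵇ-ab u v = refl
      unit : ∀ p → p ≢ u → Adj G p v → dir D p v ≡ true → wt wL p v ≡ 1
      unit p p≢u _ p→v
        rewrite pairᵇ-other {u} {v} {p} {v} (λ { (inj₁ (p≡u , _)) → p≢u p≡u ; (inj₂ (_ , v≡u)) → Adj-irrefl uv (sym v≡u) })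
              | dec-true (v ≟ᶠ v) refl | p→v = refl

    S-elsewhere : ∀ y → y ≢ v → S G D wL y ≡ S G D w y
    S-elsewhere y y≢v = sumFin-cong N (λ p → arc-cong D (wt wL) (wt w) (unchanged p))
      where
      not-uv : ∀ p → dir D p y ≡ true → ¬ SamePair u v p y
      not-uv p _   (inj₁ (_ , y≡v))     = y≢v y≡v
      not-uv p p→y (inj₂ (refl , refl)) = true≢false (trans (sym p→y) (reverse-of-arc D uv u→v))
      not-into : ∀ p → Adj G p y → dir D p y ≡ true → intoᵇ p y ≡ false
      not-into p py p→y rewrite dec-false (y ≟ᶠ v) y≢v with p ≟ᶠ v
      ... | yes refl = reverse-of-arc D py p→y
      ... | no  _    = refl
      unchanged : ∀ p → Adj G p y → dir D p y ≡ true → wt wL p y ≡ wt w p y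
      unchanged p py p→y rewrite pairᵇ-other (not-uv p p→y) | not-into p py p→y = refl

    proper : SemiProper G D w → SemiProper G D wL
    proper sp = semiProper-update D D w wL v sp S-elsewhere fresh
      where
      fresh : ∀ x → Adj G x v → S G D wL x ≢ S G D wL v
      fresh x xv rewrite S-at-v | S-elsewhere x (Adj-irrefl xv) = free x xv

    S-≤ : ∀ y → S G D wL y ≤ S G D w y
    S-≤ = at-or-away v (subst (_≤ S G D w v) (sym S-at-v) (<⇒≤ t<S)) (λ y y≢v → ≤-reflexive (S-elsewhere y y≢v))

    improvement : SemiProper G D w → Improvement D w
    improvement sp = lowerS-improvement D D w wL v (proper sp) S-≤ (subst (_< S G D w v) (sym S-at-v) t<S)

  adj? : ∀ x y → Dec (Adj G x y)
  adj? x y = adj G x y ≟ᵇ true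

  dir? : ∀ (D : Orientation G) x y → Dec (dir D x y ≡ true)
  dir? D x y = dir D x y ≟ᵇ true

  -- If S(v) ≤ 2 d⁻(v) while some arc into v weighs at least 3, some arc into v weighs exactly 1:
  -- otherwise every arc into v contributes at least 2 and the heavy one at least 3.
  light-in-arc : ∀ D w {u v} → Adj G u v → dir D u v ≡ true → 3 ≤ wt w u v → S G D w v ≤ 2 * indeg D v →
                 ∃ λ x → Adj G x v × dir D x v ≡ true × wt w x v ≡ 1
  light-in-arc D w {u} {v} uv u→v 3≤w S≤2d with any? (λ x → adj? x v ×-dec (dir? D x v ×-dec (wt w x v ≟ 1)))
  ... | yes found = found
  ... | no  none  = ⊥-elim (<⇒≱ 2d<S S≤2d)
    where
    at-least-2 : ∀ x → arc D one x v + arc D one x v ≤ arc D (wt w) x v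
    at-least-2 x with adj G x v in xv | dir D x v in x→v
    ... | true  | true  = positive≢1⇒2≤ (wt w x v) (wpos w x v xv) (λ w≡1 → none (x , xv , x→v , w≡1))
    ... | true  | false = z≤n
    ... | false | _     = z≤n
    heavy : arc D one u v + arc D one u v < arc D (wt w) u v
    heavy rewrite arc-present D one uv u→v | arc-present D (wt w) uv u→v = 3≤w
    2d<S : 2 * indeg D v < S G D w v
    2d<S = subst (_< S G D w v) (trans (sumFin-+ N (λ x → arc D one x v) (λ x → arc D one x v))
                                       (cong (indeg D v +_) (sym (+-identityʳ (indeg D v)))))
                 (sumFin-strict N u at-least-2 heavy)

  -- If S(v) > 2 d⁻(v) and no out-neighbour of v has smaller S, some value t with
  -- d⁻(v) ≤ t < S(v) is taken by no neighbour of v: the values below S(v) can only be taken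
  -- by the d⁻(v) in-neighbours, too few to cover the S(v) − d⁻(v) > d⁻(v) values.
  free-value : ∀ D w {v} → 2 * indeg D v < S G D w v →
               (∀ z → Adj G v z → dir D v z ≡ true → S G D w v ≤ S G D w z) →
               ∃ λ t → indeg D v ≤ t × t < S G D w v × (∀ x → Adj G x v → S G D w x ≢ t)
  free-value D w {v} 2d<s high = decide (anyUpTo? (λ t → (d ≤? t) ×-dec free? t) s)
    where
    d s : ℕ
    d = indeg D v
    s = S G D w v
    Free : ℕ → Set
    Free t = ∀ x → Adj G x v → S G D w x ≢ t
    free? : ∀ t → Dec (Free t)
    free? t = all? (λ x → adj? x v →-dec ¬? (S G D w x ≟ t))
    d≤s : d ≤ s
    d≤s = ≤-trans (m≤m+n d (d + 0)) (<⇒≤ 2d<s)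
    below-s : ∀ {t} → t < d + (s ∸ d) → t < s
    below-s {t} = subst (t <_) (m+[n∸m]≡n d≤s)
    taken : ¬ (∃ λ t → t < s × d ≤ t × Free t) →
            ∀ t → d ≤ t → t < d + (s ∸ d) → ∃ λ x → 1 ≤ arc D one x v × S G D w x ≡ t
    taken none t d≤t t<d+s∸d with any? (λ x → adj? x v ×-dec (S G D w x ≟ t))
    ... | no  nobody = ⊥-elim (none (t , below-s t<d+s∸d , d≤t , λ x xv Sx≡t → nobody (x , xv , Sx≡t)))
    ... | yes (x , xv , Sx≡t) with dir? D x v
    ...   | yes x→v = x , ≤-reflexive (sym (arc-present D one xv x→v)) , Sx≡t
    ...   | no ¬x→v = ⊥-elim (<⇒≱ (below-s t<d+s∸d)
                        (subst (s ≤_) Sx≡t (high x (Adj-sym xv) (arc-of-reverse D xv (¬-not ¬x→v)))))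
    s≤2d : ¬ (∃ λ t → t < s × d ≤ t × Free t) → s ≤ 2 * d
    s≤2d none = begin
      s               ≡⟨ m+[n∸m]≡n d≤s ⟨
      d + (s ∸ d)     ≤⟨ +-monoʳ-≤ d (pigeonhole N (λ x → arc D one x v) (S G D w) d (s ∸ d) (taken none)) ⟩
      d + d           ≡⟨ cong (d +_) (+-identityʳ d) ⟨
      2 * d           ∎
      where open ≤-Reasoning
    decide : Dec (∃ λ t → t < s × d ≤ t × Free t) → ∃ λ t → d ≤ t × t < s × Free t
    decide (yes (t , t<s , d≤t , free)) = t , d≤t , t<s , free
    decide (no none) = ⊥-elim (<⇒≱ 2d<s (s≤2d none))

  -- If S(v) ≤ 2d⁻(v), rebalance against a light arc into v; otherwise
  -- redirect towards an out-neighbour with smaller S (reroute or drain), and failing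
  -- that relabel v with a free value.
  improve : ∀ D w → SemiProper G D w → ∀ {u v} → Adj G u v → dir D u v ≡ true → 3 ≤ wt w u v →
            Improvement D w
  improve D w sp {u} {v} uv u→v 3≤w with m≤n⇒∃[o]m+o≡n 3≤w | S G D w v ≤? 2 * indeg D v
  ... | c , 3+c≡w | yes S≤2d =
    let (x , xv , x→v , light) = light-in-arc D w uv u→v 3≤w S≤2d
    in Rebalance.improvement D w uv u→v xv x→v c (sym 3+c≡w) light sp
  ... | c , 3+c≡w | no S≰2d with any? (λ z → adj? v z ×-dec (dir? D v z ×-dec (S G D w z <? S G D w v)))
  ...   | yes (z , vz , v→z , lower) with any? (λ y → adj? y z ×-dec (dir? D y z ×-dec ¬? (y ≟ᶠ v)))
  ...     | yes (y , yz , y→z , y≢v) = Reroute.improvement D w uv u→v (suc c) (sym 3+c≡w) vz v→z yz y→z y≢v lower sp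
  ...     | no  no-other = Drain.improvement D w uv u→v (suc c) (sym 3+c≡w) vz v→z only-v sp
    where
    only-v : ∀ x → Adj G x z → dir D x z ≡ true → x ≡ v
    only-v x xz x→z with x ≟ᶠ v
    ... | yes x≡v = x≡v
    ... | no  x≢v = ⊥-elim (no-other (x , xz , x→z , x≢v))
  improve D w sp {u} {v} uv u→v 3≤w | c , 3+c≡w | no S≰2d | no no-lower =
    let (t , d≤t , t<S , free) = free-value D w (≰⇒> S≰2d) high
    in Relabel.improvement D w uv u→v t d≤t free t<S sp
    where
    high : ∀ z → Adj G v z → dir D v z ≡ true → S G D w v ≤ S G D w z
    high z vz v→z = ≮⇒≥ (λ lower → no-lower (z , vz , v→z , lower))

  Weights12 : Weight G → Set
  Weights12 w = ∀ x y → Adj G x y → (wt w x y ≡ 1) ⊎ (wt w x y ≡ 2)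

  weights12 : ∀ D w → ¬ (∃ λ u → ∃ λ v → Adj G u v × dir D u v ≡ true × 3 ≤ wt w u v) → Weights12 w
  weights12 D w no-heavy x y xy with dir? D x y
  ... | yes x→y = one-or-two (wpos w x y xy) (λ 3≤ → no-heavy (x , y , xy , x→y , 3≤))
  ... | no ¬x→y = subst (λ k → (k ≡ 1) ⊎ (k ≡ 2)) (wsym w y x)
        (one-or-two (wpos w y x (Adj-sym xy)) (λ 3≤ → no-heavy (y , x , Adj-sym xy , arc-of-reverse D xy (¬-not ¬x→y) , 3≤)))

  Reduced : Orientation G → Weight G → Set
  Reduced D w = Σ (Orientation G) λ D′ → Σ (Weight G) λ w′ →
                SemiProper G D′ w′ × maxS G D′ w′ ≤ maxS G D w × Weights12 w′

  reduce : ∀ D w → SemiProper G D w → Reduced D w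
  reduce D w = go D w (⊏-wellFounded (potential D w))
    where
    go : ∀ D w → Acc _⊏_ (potential D w) → SemiProper G D w → Reduced D w
    go D w (acc rec) sp
      with any? (λ u → any? (λ v → adj? u v ×-dec (dir? D u v ×-dec (3 ≤? wt w u v))))
    ... | no  no-heavy = D , w , sp , ≤-refl , weights12 D w no-heavy
    ... | yes (u , v , uv , u→v , 3≤w) =
      let open Improvement (improve D w sp uv u→v 3≤w)
          (D″ , w″ , sp″ , ≤′ , w12) = go D′ w′ (rec smaller) proper
      in D″ , w″ , sp″ , ≤-trans ≤′ no-worse , w12

  _≺ᵇ_ : Fin N → Fin N → Bool
  x ≺ᵇ y = toℕ x <ᵇ toℕ y

  ≺ᵇ-true : ∀ x y → x ≺ᵇ y ≡ true → toℕ x < toℕ y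
  ≺ᵇ-true x y x≺y = <ᵇ⇒< (toℕ x) (toℕ y) (subst T (sym x≺y) _)

  ≺ᵇ-false : ∀ x y → x ≺ᵇ y ≡ false → ¬ (toℕ x < toℕ y)
  ≺ᵇ-false x y x⊀y x<y = subst T x⊀y (<⇒<ᵇ x<y)

  ≺ᵇ-asym : ∀ x y → x ≺ᵇ y ≡ true → y ≺ᵇ x ≡ true → ⊥
  ≺ᵇ-asym x y x≺y y≺x = <-asym (≺ᵇ-true x y x≺y) (≺ᵇ-true y x y≺x)

  ≺ᵇ-connex : ∀ x y → x ≺ᵇ y ≡ false → y ≺ᵇ x ≡ false → x ≡ y
  ≺ᵇ-connex x y x⊀y y⊀x = toℕ-injective (≤-antisym (≮⇒≥ (≺ᵇ-false y x y⊀x)) (≮⇒≥ (≺ᵇ-false x y x⊀y)))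

  -- A first semi-proper orientation: orient by index and weight the edge {x, y} with
  -- B^max(x,y), B = N + 1.  Then S(y) ≥ B^y at the head of an arc x → y, while
  -- S(x) ≤ N·B^x < B^(x+1) ≤ B^y.
  D₀ : Orientation G
  D₀ = record { dir = _≺ᵇ_ ; exact = exact₀ }
    where
    exact₀ : ∀ x y → Adj G x y → x ≺ᵇ y ≢ y ≺ᵇ x
    exact₀ x y xy eq with x ≺ᵇ y in x≺y | y ≺ᵇ x in y≺x
    ... | true  | true  = ≺ᵇ-asym x y x≺y y≺x
    ... | false | false = Adj-irrefl xy (≺ᵇ-connex x y x≺y y≺x)

  B : ℕ
  B = suc N

  W₀ : Weight G
  W₀ = record { wt = λ x y → B ^ (toℕ x ⊔ toℕ y) ; wsym = λ x y → cong (B ^_) (⊔-comm (toℕ x) (toℕ y))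
              ; wpos = λ x y _ → m^n>0 B (toℕ x ⊔ toℕ y) }

  S₀-upper : ∀ x → S G D₀ W₀ x < B ^ suc (toℕ x)
  S₀-upper x = begin-strict
    S G D₀ W₀ x          ≤⟨ sumFin-bound N (B ^ toℕ x) into-x ⟩
    N * B ^ toℕ x        <⟨ +-monoˡ-< (N * B ^ toℕ x) (m^n>0 B (toℕ x)) ⟩
    B ^ suc (toℕ x)      ∎
    where
    open ≤-Reasoning
    into-x : ∀ p → arc D₀ (wt W₀) p x ≤ B ^ toℕ x
    into-x p with adj G p x | p ≺ᵇ x in p≺x
    ... | true  | true  = ≤-reflexive (cong (B ^_) (m≤n⇒m⊔n≡n (<⇒≤ (≺ᵇ-true p x p≺x))))
    ... | true  | false = z≤n
    ... | false | _     = z≤n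

  S₀-increasing : ∀ {x y} → Adj G x y → x ≺ᵇ y ≡ true → S G D₀ W₀ x < S G D₀ W₀ y
  S₀-increasing {x} {y} xy x≺y = begin-strict
    S G D₀ W₀ x            <⟨ S₀-upper x ⟩
    B ^ suc (toℕ x)        ≤⟨ ^-monoʳ-≤ B (≺ᵇ-true x y x≺y) ⟩
    B ^ toℕ y              ≡⟨ cong (B ^_) (m≤n⇒m⊔n≡n (<⇒≤ (≺ᵇ-true x y x≺y))) ⟨
    B ^ (toℕ x ⊔ toℕ y)    ≤⟨ weight≤S D₀ W₀ xy x≺y ⟩
    S G D₀ W₀ y            ∎
    where open ≤-Reasoning

  D₀-proper : SemiProper G D₀ W₀
  D₀-proper x y xy with x ≺ᵇ y in x≺y | y ≺ᵇ x in y≺x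
  ... | true  | _     = <⇒≢ (S₀-increasing xy x≺y)
  ... | false | true  = ≢-sym (<⇒≢ (S₀-increasing (Adj-sym xy) y≺x))
  ... | false | false = ⊥-elim (Adj-irrefl xy (≺ᵇ-connex x y x≺y y≺x))

  -- Orientations with weights in {1, 2} are coded by finitely many bits: for each pair
  -- x < y (by index), whether x → y and whether the weight is 2.
  Code : Set
  Code = Vec (Vec (Bool × Bool) N) N

  entry : Code → Fin N → Fin N → Bool × Bool
  entry g x y = lookup (lookup g x) y

  decodeD : Code → Orientation G
  decodeD g = record { dir = dir′ ; exact = exact′ }
    where
    dir′ : Fin N → Fin N → Bool
    dir′ x y = if x ≺ᵇ y then proj₁ (entry g x y) else (if y ≺ᵇ x then not (proj₁ (entry g y x)) else false)
    exact′ : ∀ x y → Adj G x y → dir′ x y ≢ dir′ y x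
    exact′ x y xy with x ≺ᵇ y in x≺y | y ≺ᵇ x in y≺x
    ... | true  | true  = ⊥-elim (≺ᵇ-asym x y x≺y y≺x)
    ... | true  | false = not-¬ refl
    ... | false | true  = ≢-sym (not-¬ refl)
    ... | false | false = ⊥-elim (Adj-irrefl xy (≺ᵇ-connex x y x≺y y≺x))

  decodeW : Code → Weight G
  decodeW g = record { wt = wt′ ; wsym = wsym′ ; wpos = λ x y _ → wpos′ x y }
    where
    wt′ : Fin N → Fin N → ℕ
    wt′ x y = if x ≺ᵇ y then weightOf (proj₂ (entry g x y)) else weightOf (proj₂ (entry g y x))
    wsym′ : ∀ x y → wt′ x y ≡ wt′ y x
    wsym′ x y with x ≺ᵇ y in x≺y | y ≺ᵇ x in y≺x
    ... | true  | true  = ⊥-elim (≺ᵇ-asym x y x≺y y≺x)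
    ... | true  | false = refl
    ... | false | true  = refl
    ... | false | false rewrite ≺ᵇ-connex x y x≺y y≺x = refl
    wpos′ : ∀ x y → 0 < wt′ x y
    wpos′ x y with x ≺ᵇ y
    ... | true  = weightOf-pos _
    ... | false = weightOf-pos _

  decodeW-12 : ∀ g → Weights12 (decodeW g)
  decodeW-12 g x y _ with x ≺ᵇ y
  ... | true  = weightOf-12 (proj₂ (entry g x y))
  ... | false = weightOf-12 (proj₂ (entry g y x))

  encode : Orientation G → Weight G → Code
  encode D w = tabulate (λ x → tabulate (λ y → dir D x y , does (wt w x y ≟ 2)))

  entry-encode : ∀ D w x y → entry (encode D w) x y ≡ (dir D x y , does (wt w x y ≟ 2))
  entry-encode D w x y
    rewrite lookup∘tabulate (λ x → tabulate (λ y → dir D x y , does (wt w x y ≟ 2))) x =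
    lookup∘tabulate (λ y → dir D x y , does (wt w x y ≟ 2)) y

  S-ext : ∀ D D′ w w′ → (∀ x y → Adj G x y → dir D′ x y ≡ dir D x y) → (∀ x y → Adj G x y → wt w′ x y ≡ wt w x y) →
          ∀ v → S G D′ w′ v ≡ S G D w v
  S-ext D D′ w w′ same-dir same-wt v = sumFin-cong N agree
    where
    agree : ∀ x → arc D′ (wt w′) x v ≡ arc D (wt w) x v
    agree x with adj G x v in xv
    ... | true  rewrite same-dir x v xv | same-wt x v xv = refl
    ... | false = refl

  decode-encode : ∀ D w → Weights12 w → ∀ v → S G (decodeD (encode D w)) (decodeW (encode D w)) v ≡ S G D w v
  decode-encode D w w12 = S-ext D (decodeD g) w (decodeW g) same-dir same-wt
    where
    g : Code
    g = encode D w
    same-dir : ∀ x y → Adj G x y → dir (decodeD g) x y ≡ dir D x y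
    same-dir x y xy with x ≺ᵇ y in x≺y | y ≺ᵇ x in y≺x
    ... | true  | _     rewrite entry-encode D w x y = refl
    ... | false | true  rewrite entry-encode D w y x | dir-reverse D xy = not-involutive (dir D x y)
    ... | false | false = ⊥-elim (Adj-irrefl xy (≺ᵇ-connex x y x≺y y≺x))
    same-wt : ∀ x y → Adj G x y → wt (decodeW g) x y ≡ wt w x y
    same-wt x y xy with x ≺ᵇ y
    ... | true  rewrite entry-encode D w x y = weightOf-code (w12 x y xy)
    ... | false rewrite entry-encode D w y x = trans (weightOf-code (w12 y x (Adj-sym xy))) (wsym w y x)

  Achievable : ℕ → Set
  Achievable k = ∃ λ g → SemiProper G (decodeD g) (decodeW g) × maxS G (decodeD g) (decodeW g) ≤ k

  achievable? : ∀ k → Dec (Achievable k)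
  achievable? k = exhaustible-Vec (exhaustible-Vec (exhaustible-× exhaustible-Bool exhaustible-Bool) N) N _
    (λ g → semiProper? g ×-dec (maxS G (decodeD g) (decodeW g) ≤? k))
    where
    semiProper? : ∀ g → Dec (SemiProper G (decodeD g) (decodeW g))
    semiProper? g = all? λ x → all? λ y →
      adj? x y →-dec ¬? (S G (decodeD g) (decodeW g) x ≟ S G (decodeD g) (decodeW g) y)

  achieve : ∀ D w → SemiProper G D w → Achievable (maxS G D w)
  achieve D w sp =
    let (D′ , w′ , sp′ , ≤max , w12) = reduce D w sp
        g = encode D′ w′
        same = decode-encode D′ w′ w12
    in g , semiProper-≗ D′ (decodeD g) w′ (decodeW g) sp′ same
         , ≤-trans (maxS-mono D′ (decodeD g) w′ (decodeW g) (≤-reflexive ∘ same)) ≤max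

theorem1 : (G : Graph) →
    Σ (Orientation G) (λ D → Σ (Weight G) (λ w →
    Optimal G D w ×
    (∀ u v → Adj G u v → (wt w u v ≡ 1) ⊎ (wt w u v ≡ 2))))
theorem1 G with least (achievable? G) (maxS G (D₀ G) (W₀ G)) (achieve G (D₀ G) (W₀ G) (D₀-proper G))
... | k , (g , proper , max≤k) , below = decodeD G g , decodeW G g , (proper , optimal) , decodeW-12 G g
  where
  optimal : ∀ D w → SemiProper G D w → maxS G (decodeD G g) (decodeW G g) ≤ maxS G D w
  optimal D w sp = ≤-trans max≤k (≮⇒≥ λ lt → below _ lt (achieve G D w sp))
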